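{- Let $k \geq 3$ and let $A = \{a_1, a_2, \ldots, a_k\}$ be a set of $k$ positive integers with $a_1 < a_2 < \cdots < a_k$ and $d(A) = 1$. Then \[ |S(A)| \geq \begin{cases} a_k + \dfrac{k(k-1)}{2} & \text{if } a_k \leq 2k-3,\\[2mm] \theta(k+1) - 4 + \dfrac{k(k-1)}{2} & \text{if } a_k \geq 2k-2. \end{cases} \]
   Context: For a nonempty finite set $A$ of integers, $S(A) = \{\sum_{b\in B} b : \emptyset \neq B \subseteq A\}$ is the set of all nonempty subset sums of $A$. $d(A)$ denotes the greatest common divisor of the elements of $A$. $\theta = \frac{1+\sqrt{5}}{2}$ is the golden mean. -}

module Defs where

open import Data.Nat using (ℕ; zero; suc; _+_; _*_; _∸_; _/_)
open import Data.Nat.GCD using (gcd)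
open import Data.List using (List; []; _∷_; map; _++_; length; deduplicate; foldr)
import Data.Nat as ℕ
open import Data.Integer as ℤ using (ℤ)
open import Data.Product using (_×_)

nonemptySubsetSums : List ℕ → List ℕ
nonemptySubsetSums []       = []
nonemptySubsetSums (a ∷ as) =
  a ∷ (map (λ s → a + s) (nonemptySubsetSums as) ++ nonemptySubsetSums as)

cardS : List ℕ → ℕ
cardS A = length (deduplicate ℕ._≟_ (nonemptySubsetSums A))

-- d(A) : gcd of the elements (gcd of the empty list is 0).
gcdList : List ℕ → ℕ
gcdList = foldr gcd 0

-- k(k-1)/2 (exact, since k(k-1) is even)
tri : ℕ → ℕ
tri k = (k * (k ∸ 1)) / 2

-- x ≥ θ·m  where θ = (1+√5)/2, for integer x and natural m.
-- Equivalently 2x - m ≥ √5·m, i.e. 2x - m ≥ 0 and (2x - m)² ≥ 5m².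
AtLeastGoldenTimes : ℤ → ℕ → Set
AtLeastGoldenTimes x m =
  (ℤ.+ m ℤ.≤ ℤ.+ 2 ℤ.* x) × ((ℤ.+ 5) ℤ.* (ℤ.+ m) ℤ.* (ℤ.+ m) ℤ.≤ (ℤ.+ 2 ℤ.* x ℤ.- ℤ.+ m) ℤ.* (ℤ.+ 2 ℤ.* x ℤ.- ℤ.+ m))
  where open import Data.Product renaming (_×_ to _×_)

-- Let a be the largest element of A and A′ = A ∖ {a}, and count subset sums with the empty
-- one. Every residue class mod a that contains a subset sum of A′ also contains a subset sum
-- of A that is not one of A′ (climb in steps of a until leaving the sums of A′), so adding a
-- contributes at least as many new sums as there are residues mod a of sums of A′. The
-- residues of 0 and of the elements of A′ are distinct, which gives 1 + k(k+1)/2 sums by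
-- induction. If a ≤ 2k − 3, every residue mod a is a sum of at most two elements of A′
-- (pigeonhole on complementary pairs), and the first bound follows. If a ≥ 2k − 2 we show
-- |S(A)| ≥ k(k−1)/2 + 2k − 3 by induction on k, which implies the golden-ratio bound. Let b
-- be the second largest element. If b is small, the interval (b, 2k − 2) consists of sums
-- of two elements of A′. If d(A′) = 1, induction applies to A′, and some sum of two
-- elements of A′ has a residue outside {0} ∪ A′, since otherwise A′ = {1, …, a − 1},
-- contradicting a ≥ 2|A′|. If d(A′) > 1, the sums of A′ and their translates by a are
-- disjoint, so the count doubles.

module Submission where

open import Level using (0ℓ)
open import Function using (_∘_; id; flip)
open import Data.Bool using (if_then_else_)
open import Data.Empty using (⊥)
open import Data.Product using (∃; ∃₂; _×_; _,_; proj₁; proj₂)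
open import Data.Sum using (_⊎_; inj₁; inj₂)
open import Data.Maybe using (just)
open import Relation.Nullary using (Dec; yes; no; ¬_; does; contradiction)
open import Relation.Nullary.Decidable using (_×-dec_; ¬?)
open import Relation.Unary using (Pred; Decidable)
open import Relation.Unary.Properties using (_∪?_; _∩?_; ∁?; U?)
open import Relation.Binary.PropositionalEquality

open import Data.Nat
open import Data.Nat.Properties
open import Data.Nat.DivMod
open import Data.Nat.Divisibility
open import Data.Nat.GCD using (gcd[m,n]∣m; gcd[m,n]∣n; gcd-greatest)
open import Data.Nat.Induction using (<-rec)
open import Data.Nat.ListAction using (sum)
open import Data.Nat.Tactic.RingSolver using (solve-∀)
open import Algebra.Properties.CommutativeSemigroup +-commutativeSemigroup using (x∙yz≈y∙xz)
import Data.Integer as ℤ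
import Data.Integer.Properties as ℤP

open import Data.List using (List; []; _∷_; length; map; deduplicate; reverse; _∷ʳ_; last)
open import Data.List.Properties using (unfold-reverse; length-reverse)
open import Data.List.Extrema ≤-totalOrder using (min; min≤⊤; min≤xs; argmin-sel)
open import Data.List.Membership.Propositional using (_∈_; _∉_)
open import Data.List.Membership.Propositional.Properties using (∈-map⁺; ∈-++⁺ˡ; ∈-++⁺ʳ; ∈-deduplicate⁺)
open import Data.List.Membership.DecPropositional _≟_ using (_∈?_)
open import Data.List.Relation.Unary.All as All using (All; []; _∷_)
open import Data.List.Relation.Unary.AllPairs as AllPairs using (AllPairs; []; _∷_)
open import Data.List.Relation.Unary.AllPairs.Properties as AllPairs using ()
open import Data.List.Relation.Unary.Any using (here; there)
open import Data.List.Relation.Unary.Any.Properties as Any using ()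
open import Data.List.Relation.Unary.Linked using (Linked)
open import Data.List.Relation.Unary.Linked.Properties using (Linked⇒AllPairs)
open import Data.List.Relation.Unary.Unique.Propositional using (Unique)
open import Data.List.Relation.Binary.Permutation.Propositional as ↭ using (_↭_)
open import Data.List.Relation.Binary.Permutation.Propositional.Properties using (↭-reverse)

open import Defs

variable
  xs : List ℕ
  P Q : Pred ℕ 0ℓ

-- Counting

count : Decidable P → ℕ → ℕ
count P? zero    = 0
count P? (suc n) = if does (P? n) then suc (count P? n) else count P? n

count-mono : (P? : Decidable P) (Q? : Decidable Q) (N : ℕ) →
             (∀ {n} → n < N → P n → Q n) → count P? N ≤ count Q? N
count-mono P? Q? zero    P⊆Q = z≤n
count-mono P? Q? (suc N) P⊆Q with P? N | Q? N | count-mono P? Q? N (P⊆Q ∘ m<n⇒m<1+n)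
... | yes p | yes _  | ih = s≤s ih
... | yes p | no ¬q  | _  = contradiction (P⊆Q ≤-refl p) ¬q
... | no _  | yes _  | ih = m≤n⇒m≤1+n ih
... | no _  | no _   | ih = ih

count-∪ : (P? : Decidable P) (Q? : Decidable Q) (N : ℕ) → (∀ {n} → P n → Q n → ⊥) →
          count (P? ∪? Q?) N ≡ count P? N + count Q? N
count-∪ P? Q? zero    disjoint = refl
count-∪ P? Q? (suc N) disjoint with P? N | Q? N | count-∪ P? Q? N disjoint
... | yes p | yes q | _  = contradiction q (disjoint p)
... | yes _ | no _  | ih = cong suc ih
... | no _  | yes _ | ih = trans (cong suc ih) (sym (+-suc _ _))
... | no _  | no _  | ih = ih

count-∪≤ : (P? : Decidable P) (Q? : Decidable Q) (N : ℕ) → count (P? ∪? Q?) N ≤ count P? N + count Q? N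
count-∪≤ P? Q? zero    = z≤n
count-∪≤ P? Q? (suc N) with P? N | Q? N | count-∪≤ P? Q? N
... | yes _ | yes _ | ih = s≤s (≤-trans ih (+-monoʳ-≤ _ (n≤1+n _)))
... | yes _ | no _  | ih = s≤s ih
... | no _  | yes _ | ih = ≤-trans (s≤s ih) (≤-reflexive (sym (+-suc _ _)))
... | no _  | no _  | ih = ih

count-≤ : (P? : Decidable P) (N : ℕ) → count P? N ≤ N
count-≤ P? zero    = z≤n
count-≤ P? (suc N) with P? N
... | yes _ = s≤s (count-≤ P? N)
... | no _  = m≤n⇒m≤1+n (count-≤ P? N)

count-all : (P? : Decidable P) (N : ℕ) → (∀ {n} → n < N → P n) → count P? N ≡ N
count-all P? zero    all = refl
count-all P? (suc N) all with P? N
... | yes _  = cong suc (count-all P? N (all ∘ m<n⇒m<1+n))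
... | no ¬p = contradiction (all ≤-refl) ¬p

count-none : (P? : Decidable P) (N : ℕ) → (∀ {n} → n < N → ¬ P n) → count P? N ≡ 0
count-none P? zero    none = refl
count-none P? (suc N) none with P? N
... | yes p = contradiction p (none ≤-refl)
... | no _  = count-none P? N (none ∘ m<n⇒m<1+n)

count-+ : (P? : Decidable P) (m n : ℕ) → count P? (m + n) ≡ count P? m + count (λ i → P? (m + i)) n
count-+ P? m zero rewrite +-identityʳ m = sym (+-identityʳ _)
count-+ P? m (suc n) rewrite +-suc m n with P? (m + n) | count-+ P? m n
... | yes _ | ih = trans (cong suc ih) (sym (+-suc _ _))
... | no _  | ih = ih

count-shift : (P? : Decidable P) → ¬ P 0 → ∀ n → count P? (suc n) ≡ count (P? ∘ suc) n
count-shift P? ¬p₀ n with P? 0 | count-+ P? 1 n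
... | yes p₀ | _  = contradiction p₀ ¬p₀
... | no _   | eq = eq

count-skip : ∀ {n} (P? : Decidable P) → ¬ P n → count P? (suc n) ≡ count P? n
count-skip {n = n} P? ¬p with P? n
... | yes p = contradiction p ¬p
... | no _  = refl

count-monoʳ : ∀ {m n} (P? : Decidable P) → m ≤ n → count P? m ≤ count P? n
count-monoʳ {m = m} {n = n} P? m≤n = begin
  count P? m                                       ≤⟨ m≤m+n _ _ ⟩
  count P? m + count (λ i → P? (m + i)) (n ∸ m)    ≡⟨ count-+ P? m (n ∸ m) ⟨
  count P? (m + (n ∸ m))                           ≡⟨ cong (count P?) (m+[n∸m]≡n m≤n) ⟩
  count P? n                                       ∎
  where open ≤-Reasoning

count-≤1 : (P? : Decidable P) (N : ℕ) → (∀ {m n} → P m → P n → m ≡ n) → count P? N ≤ 1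
count-≤1 P? zero    unique = z≤n
count-≤1 P? (suc N) unique with P? N
... | yes p = s≤s (≤-reflexive (count-none P? N (λ n<N q → <-irrefl (unique q p) n<N)))
... | no _  = count-≤1 P? N unique

count-≥1 : ∀ {N} (P? : Decidable P) {c} → P c → c < N → 1 ≤ count P? N
count-≥1 {N = suc N} P? {c} p c<1+N with P? N
... | yes _  = s≤s z≤n
... | no ¬q  = count-≥1 P? p (≤∧≢⇒< (s≤s⁻¹ c<1+N) (λ { refl → ¬q p }))

count-∈≤length : ∀ N (xs : List ℕ) → count (_∈? xs) N ≤ length xs
count-∈≤length N [] = ≤-reflexive (count-none (_∈? []) N (λ _ ()))
count-∈≤length N (x ∷ xs) = begin
  count (_∈? x ∷ xs) N                   ≤⟨ count-mono (_∈? x ∷ xs) ((_≟ x) ∪? (_∈? xs)) N split ⟩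
  count ((_≟ x) ∪? (_∈? xs)) N           ≤⟨ count-∪≤ (_≟ x) (_∈? xs) N ⟩
  count (_≟ x) N + count (_∈? xs) N      ≤⟨ +-mono-≤ (count-≤1 (_≟ x) N (λ { refl refl → refl }))
                                                      (count-∈≤length N xs) ⟩
  suc (length xs)                        ∎
  where
  open ≤-Reasoning
  split : ∀ {n} → n < N → n ∈ x ∷ xs → n ≡ x ⊎ n ∈ xs
  split _ (here n≡x)  = inj₁ n≡x
  split _ (there n∈xs) = inj₂ n∈xs

length≤count-∈ : ∀ {N} → Unique xs → All (_< N) xs → length xs ≤ count (_∈? xs) N
length≤count-∈ [] [] = z≤n
length≤count-∈ {x ∷ xs} {N} (x∉xs ∷ uniq) (x<N ∷ xs<N) = begin
  suc (length xs)                        ≤⟨ +-mono-≤ (count-≥1 (_≟ x) refl x<N) (length≤count-∈ uniq xs<N) ⟩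
  count (_≟ x) N + count (_∈? xs) N      ≡⟨ count-∪ (_≟ x) (_∈? xs) N disjoint ⟨
  count ((_≟ x) ∪? (_∈? xs)) N           ≤⟨ count-mono ((_≟ x) ∪? (_∈? xs)) (_∈? x ∷ xs) N join ⟩
  count (_∈? x ∷ xs) N                   ∎
  where
  open ≤-Reasoning
  disjoint : ∀ {n} → n ≡ x → n ∈ xs → ⊥
  disjoint refl n∈xs = All.lookup x∉xs n∈xs refl
  join : ∀ {n} → n < N → n ≡ x ⊎ n ∈ xs → n ∈ x ∷ xs
  join _ (inj₁ n≡x)  = here n≡x
  join _ (inj₂ n∈xs) = there n∈xs

count-≤-image : (P? : Decidable P) (Q? : Decidable Q) (g : ℕ → ℕ) (M N : ℕ) →
                (∀ {r} → r < M → P r → ∃ λ n → n < N × Q n × g n ≡ r) → count P? M ≤ count Q? N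
count-≤-image P? Q? g M zero    image = ≤-reflexive (count-none P? M λ r<M p → n≮0 (proj₁ (proj₂ (image r<M p))))
count-≤-image {P} {Q} P? Q? g M (suc N) image with Q? N
... | no ¬q = count-≤-image P? Q? g M N λ r<M p → below (image r<M p)
  where
  below : ∀ {r} → (∃ λ n → n < suc N × Q n × g n ≡ r) → ∃ λ n → n < N × Q n × g n ≡ r
  below (n , n<1+N , q , gn≡r) = n , ≤∧≢⇒< (s≤s⁻¹ n<1+N) (λ { refl → ¬q q }) , q , gn≡r
... | yes _ = begin
  count P? M                                 ≤⟨ count-mono P? (P′? ∪? (_≟ g N)) M split ⟩
  count (P′? ∪? (_≟ g N)) M                  ≤⟨ count-∪≤ P′? (_≟ g N) M ⟩
  count P′? M + count (_≟ g N) M             ≤⟨ +-mono-≤ (count-≤-image P′? Q? g M N image′)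
                                                         (count-≤1 (_≟ g N) M λ { refl refl → refl }) ⟩
  count Q? N + 1                             ≡⟨ +-comm _ 1 ⟩
  suc (count Q? N)                           ∎
  where
  open ≤-Reasoning
  P′? : Decidable (λ r → P r × r ≢ g N)
  P′? = P? ∩? ∁? (_≟ g N)
  split : ∀ {r} → r < M → P r → (P r × r ≢ g N) ⊎ r ≡ g N
  split {r} _ p with r ≟ g N
  ... | yes r≡gN = inj₂ r≡gN
  ... | no r≢gN  = inj₁ (p , r≢gN)
  image′ : ∀ {r} → r < M → P r × r ≢ g N → ∃ λ n → n < N × Q n × g n ≡ r
  image′ r<M (p , r≢gN) with image r<M p
  ... | n , n<1+N , q , gn≡r = n , ≤∧≢⇒< (s≤s⁻¹ n<1+N) (λ { refl → r≢gN (sym gn≡r) }) , q , gn≡r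

count-peel : (P? : Decidable P) (l : ℕ) → (P 0 × P (suc l)) ⊎ count P? (2 + l) ≤ suc (count (P? ∘ suc) l)
count-peel P? l with P? 0 | P? (suc l) | count-+ P? 1 l
... | yes p₀ | yes pₗ | _  = inj₁ (p₀ , pₗ)
... | yes _  | no _   | eq = inj₂ (≤-reflexive eq)
... | no _   | yes _  | eq = inj₂ (s≤s (≤-reflexive eq))
... | no _   | no _   | eq = inj₂ (≤-trans (≤-reflexive eq) (n≤1+n _))

complementaryPair : (P? : Decidable P) (n : ℕ) → 2 + n ≤ 2 * count P? n →
                    ∃₂ λ x y → x < y × P x × P y × suc (x + y) ≡ n
complementaryPair P? 0 ()
complementaryPair P? 1 large with ≤-trans large (*-monoʳ-≤ 2 (count-≤ P? 1))
... | s≤s (s≤s ())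
complementaryPair P? (suc (suc l)) large with count-peel P? l
... | inj₁ (p₀ , pₗ) = 0 , suc l , s≤s z≤n , p₀ , pₗ , refl
... | inj₂ peeled with complementaryPair (P? ∘ suc) l (+-cancelˡ-≤ 2 _ _ (begin
      2 + suc (suc l)                 ≤⟨ large ⟩
      2 * count P? (suc (suc l))      ≤⟨ *-monoʳ-≤ 2 peeled ⟩
      2 * suc (count (P? ∘ suc) l)    ≡⟨ *-suc 2 _ ⟩
      2 + 2 * count (P? ∘ suc) l      ∎))
  where open ≤-Reasoning
...   | x , y , x<y , px , py , eq = suc x , suc y , s≤s x<y , px , py , cong (suc ∘ suc) (trans (+-suc x y) eq)

-- Subset sums

data SubsetSum : List ℕ → ℕ → Set where
  []   : SubsetSum [] 0
  skip : ∀ {x xs n} → SubsetSum xs n → SubsetSum (x ∷ xs) n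
  take : ∀ {x xs n} → SubsetSum xs n → SubsetSum (x ∷ xs) (x + n)

subsetSum? : ∀ xs → Decidable (SubsetSum xs)
subsetSum? []       zero    = yes []
subsetSum? []       (suc n) = no λ ()
subsetSum? (x ∷ xs) n with subsetSum? xs n | x ≤? n
... | yes s | _       = yes (skip s)
... | no ¬s | no x≰n  = no λ { (skip s) → ¬s s ; (take _) → x≰n (m≤m+n x _) }
... | no ¬s | yes x≤n with subsetSum? xs (n ∸ x)
...   | yes s  = yes (subst (SubsetSum (x ∷ xs)) (m+[n∸m]≡n x≤n) (take s))
...   | no ¬s′ = no λ { (skip s) → ¬s s ; (take s) → ¬s′ (subst (SubsetSum xs) (sym (m+n∸m≡n x _)) s) }

0∉-positive : All (0 <_) xs → 0 ∉ xs
0∉-positive positive 0∈xs = <-irrefl refl (All.lookup positive 0∈xs)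

subsetSum-0 : ∀ xs → SubsetSum xs 0
subsetSum-0 []       = []
subsetSum-0 (x ∷ xs) = skip (subsetSum-0 xs)

subsetSum-∈ : ∀ {x} → x ∈ xs → SubsetSum xs x
subsetSum-∈ {x ∷ xs} (here refl) = subst (SubsetSum (x ∷ xs)) (+-identityʳ x) (take (subsetSum-0 xs))
subsetSum-∈ (there x∈xs) = skip (subsetSum-∈ x∈xs)

subsetSum-pair : ∀ {x y} → x ∈ xs → y ∈ xs → x ≢ y → SubsetSum xs (x + y)
subsetSum-pair (here refl)  (here refl)  x≢y = contradiction refl x≢y
subsetSum-pair (here refl)  (there y∈xs) _   = take (subsetSum-∈ y∈xs)
subsetSum-pair {y = y} (there x∈xs) (here refl) _ = subst (SubsetSum _) (+-comm y _) (take (subsetSum-∈ x∈xs))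
subsetSum-pair (there x∈xs) (there y∈xs) x≢y = skip (subsetSum-pair x∈xs y∈xs x≢y)

subsetSum-≤ : ∀ {n} → SubsetSum xs n → n ≤ sum xs
subsetSum-≤ []                = z≤n
subsetSum-≤ (skip {x = x} s)  = ≤-trans (subsetSum-≤ s) (m≤n+m _ x)
subsetSum-≤ (take s)          = +-monoʳ-≤ _ (subsetSum-≤ s)

subsetSum-∣ : ∀ {d n} → All (d ∣_) xs → SubsetSum xs n → d ∣ n
subsetSum-∣ []          []       = _ ∣0
subsetSum-∣ (_ ∷ d∣xs)  (skip s) = subsetSum-∣ d∣xs s
subsetSum-∣ (d∣x ∷ d∣xs) (take s) = ∣m∣n⇒∣m+n d∣x (subsetSum-∣ d∣xs s)

gcdList-∣ : ∀ xs → All (gcdList xs ∣_) xs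
gcdList-∣ []       = []
gcdList-∣ (x ∷ xs) = gcd[m,n]∣m x _ ∷ All.map (∣-trans (gcd[m,n]∣n x _)) (gcdList-∣ xs)

∣-gcdList : ∀ {d} xs → All (d ∣_) xs → d ∣ gcdList xs
∣-gcdList []       []           = _ ∣0
∣-gcdList (x ∷ xs) (d∣x ∷ d∣xs) = gcd-greatest d∣x (∣-gcdList xs d∣xs)

subsetSum-↭ : ∀ {ys n} → xs ↭ ys → SubsetSum xs n → SubsetSum ys n
subsetSum-↭ ↭.refl           s               = s
subsetSum-↭ (↭.prep x p)     (skip s)        = skip (subsetSum-↭ p s)
subsetSum-↭ (↭.prep x p)     (take s)        = take (subsetSum-↭ p s)
subsetSum-↭ (↭.swap x y p)   (skip (skip s)) = skip (skip (subsetSum-↭ p s))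
subsetSum-↭ (↭.swap x y p)   (skip (take s)) = take (skip (subsetSum-↭ p s))
subsetSum-↭ (↭.swap x y p)   (take (skip s)) = skip (take (subsetSum-↭ p s))
subsetSum-↭ (↭.swap x y p)   (take (take {n = n} s)) =
  subst (SubsetSum _) (x∙yz≈y∙xz y x n) (take (take (subsetSum-↭ p s)))
subsetSum-↭ (↭.trans p q)    s               = subsetSum-↭ q (subsetSum-↭ p s)

subsetSum⇒nonemptySubsetSum : ∀ {n} → SubsetSum xs n → 0 < n → n ∈ nonemptySubsetSums xs
subsetSum⇒nonemptySubsetSum (skip {x = x} {xs} s) 0<n =
  there (∈-++⁺ʳ (map (x +_) (nonemptySubsetSums xs)) (subsetSum⇒nonemptySubsetSum s 0<n))
subsetSum⇒nonemptySubsetSum (take {x = x} {n = zero} s)  _ = here (+-identityʳ x)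
subsetSum⇒nonemptySubsetSum (take {n = suc _} s)         _ =
  there (∈-++⁺ˡ (∈-map⁺ _ (subsetSum⇒nonemptySubsetSum s (s≤s z≤n))))

count-subsetSum≤cardS : ∀ N xs → count (subsetSum? xs) N ≤ suc (cardS xs)
count-subsetSum≤cardS N xs = begin
  count (subsetSum? xs) N                     ≤⟨ count-mono (subsetSum? xs) ((_≟ 0) ∪? (_∈? sums)) N split ⟩
  count ((_≟ 0) ∪? (_∈? sums)) N              ≤⟨ count-∪≤ (_≟ 0) (_∈? sums) N ⟩
  count (_≟ 0) N + count (_∈? sums) N         ≤⟨ +-mono-≤ (count-≤1 (_≟ 0) N λ { refl refl → refl })
                                                          (count-∈≤length N sums) ⟩
  suc (cardS xs)                              ∎
  where
  open ≤-Reasoning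
  sums : List ℕ
  sums = deduplicate _≟_ (nonemptySubsetSums xs)
  split : ∀ {n} → n < N → SubsetSum xs n → n ≡ 0 ⊎ n ∈ sums
  split {zero}  _ _ = inj₁ refl
  split {suc n} _ s = inj₂ (∈-deduplicate⁺ _≟_ (subsetSum⇒nonemptySubsetSum s (s≤s z≤n)))

-- The empty sum 0 is counted too, hence the suc when comparing with cardS.
#sums : List ℕ → ℕ
#sums xs = count (subsetSum? xs) (suc (sum xs))

-- Adding an element

NewSum : ℕ → List ℕ → Pred ℕ 0ℓ
NewSum a xs n = SubsetSum (a ∷ xs) n × ¬ SubsetSum xs n

newSum? : ∀ a xs → Decidable (NewSum a xs)
newSum? a xs n = subsetSum? (a ∷ xs) n ×-dec ¬? (subsetSum? xs n)

#sums-∷ : ∀ a xs → #sums xs + count (newSum? a xs) (suc (a + sum xs)) ≤ #sums (a ∷ xs)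
#sums-∷ a xs = begin
  #sums xs + count New? N                       ≤⟨ +-monoˡ-≤ _ (count-monoʳ (subsetSum? xs) (s≤s (m≤n+m _ a))) ⟩
  count (subsetSum? xs) N + count New? N        ≡⟨ count-∪ (subsetSum? xs) New? N (λ s (_ , ¬s) → ¬s s) ⟨
  count (subsetSum? xs ∪? New?) N               ≤⟨ count-mono (subsetSum? xs ∪? New?) (subsetSum? (a ∷ xs)) N join ⟩
  #sums (a ∷ xs)                                ∎
  where
  open ≤-Reasoning
  N : ℕ
  N = suc (a + sum xs)
  New? : Decidable (NewSum a xs)
  New? = newSum? a xs
  join : ∀ {n} → n < N → SubsetSum xs n ⊎ NewSum a xs n → SubsetSum (a ∷ xs) n
  join _ (inj₁ s)       = skip s
  join _ (inj₂ (s , _)) = s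

ResidueOfSum : List ℕ → (a : ℕ) → .{{NonZero a}} → Pred ℕ 0ℓ
ResidueOfSum xs a r = ∃ λ s → SubsetSum xs s × s % a ≡ r

residueOfSum-< : ∀ {a} .{{_ : NonZero a}} {r} → r < a → SubsetSum xs r → ResidueOfSum xs a r
residueOfSum-< r<a s = _ , s , m<n⇒m%n≡m r<a

residueOfSum-0∷ : ∀ {a} .{{_ : NonZero a}} {ys r} → r < a → r ∈ 0 ∷ ys → ResidueOfSum ys a r
residueOfSum-0∷ {ys = ys} r<a (here refl)  = residueOfSum-< r<a (subsetSum-0 ys)
residueOfSum-0∷ r<a (there r∈ys)           = residueOfSum-< r<a (subsetSum-∈ r∈ys)

0∷-unique : ∀ {ys} → AllPairs _>_ ys → All (0 <_) ys → Unique (0 ∷ ys)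
0∷-unique desc positive = All.map (λ 0<y → <⇒≢ 0<y) positive ∷ AllPairs.map >⇒≢ desc

newSum-sameResidue : ∀ a .{{_ : NonZero a}} xs {s} → SubsetSum xs s →
                     ∃ λ n → n < suc (a + sum xs) × NewSum a xs n × n % a ≡ s % a
newSum-sameResidue a xs ss = climb (sum xs) ss (m≤m+n _ _)
  where
  a+s%a≡s%a : ∀ s → (a + s) % a ≡ s % a
  a+s%a≡s%a s = trans (cong (_% a) (+-comm a s)) ([m+n]%n≡m%n s a)
  -- Walk s, a + s, 2a + s, … until leaving the sums of xs; d bounds the remaining steps.
  climb : ∀ d {s} → SubsetSum xs s → sum xs ≤ d + s →
          ∃ λ n → n < suc (a + sum xs) × NewSum a xs n × n % a ≡ s % a
  climb d {s} ss σ≤d+s with subsetSum? xs (a + s)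
  climb d       {s} ss σ≤d+s | no ¬ss′ =
    a + s , s≤s (+-monoʳ-≤ a (subsetSum-≤ ss)) , (take ss , ¬ss′) , a+s%a≡s%a s
  climb zero    {s} ss σ≤s   | yes ss′ =
    contradiction (≤-trans (subsetSum-≤ ss′) σ≤s) (<⇒≱ (m<n+m s (>-nonZero⁻¹ a)))
  climb (suc d) {s} ss σ≤d+s | yes ss′ with climb d ss′ (≤-trans σ≤d+s (≤-trans (≤-reflexive (sym (+-suc d s)))
                                                           (+-monoʳ-≤ d (+-monoˡ-≤ s (>-nonZero⁻¹ a)))))
  ... | n , n<N , new , n%a≡[a+s]%a = n , n<N , new , trans n%a≡[a+s]%a (a+s%a≡s%a s)

#sums-∷-residues : ∀ a .{{_ : NonZero a}} xs (P? : Decidable P) →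
                   (∀ {r} → r < a → P r → ResidueOfSum xs a r) → #sums xs + count P? a ≤ #sums (a ∷ xs)
#sums-∷-residues {P} a xs P? reach =
  ≤-trans (+-monoʳ-≤ (#sums xs) (count-≤-image P? (newSum? a xs) (_% a) a (suc (a + sum xs)) image)) (#sums-∷ a xs)
  where
  image : ∀ {r} → r < a → P r → ∃ λ n → n < suc (a + sum xs) × NewSum a xs n × n % a ≡ r
  image r<a p with reach r<a p
  ... | s , ss , s%a≡r with newSum-sameResidue a xs ss
  ...   | n , n<N , new , n%a≡s%a = n , n<N , new , trans n%a≡s%a s%a≡r

#sums-∷-distinct : ∀ a .{{_ : NonZero a}} xs {rs} → Unique rs → All (_< a) rs → All (ResidueOfSum xs a) rs →
                   #sums xs + length rs ≤ #sums (a ∷ xs)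
#sums-∷-distinct a xs {rs} unique rs<a reach =
  ≤-trans (+-monoʳ-≤ (#sums xs) (length≤count-∈ unique rs<a))
          (#sums-∷-residues a xs (_∈? rs) λ _ r∈rs → All.lookup reach r∈rs)

#sums-∷-doubling : ∀ a xs → (∀ {s} → SubsetSum xs s → ¬ SubsetSum xs (a + s)) → #sums xs + #sums xs ≤ #sums (a ∷ xs)
#sums-∷-doubling a xs disjoint =
  ≤-trans (+-monoʳ-≤ (#sums xs) (count-≤-image (subsetSum? xs) (newSum? a xs) (_∸ a) _ _ image)) (#sums-∷ a xs)
  where
  image : ∀ {s} → s < suc (sum xs) → SubsetSum xs s → ∃ λ n → n < suc (a + sum xs) × NewSum a xs n × n ∸ a ≡ s
  image {s} s<1+σ ss = a + s , s≤s (+-monoʳ-≤ a (s≤s⁻¹ s<1+σ)) , (take ss , disjoint ss) , m+n∸m≡n a s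

-- Residues of sums of at most two elements

pairSum-interval : ∀ ys lo n → 2 + n ≤ 2 * count (λ i → lo + i ∈? ys) n →
                   ∃ λ s → SubsetSum ys s × suc s ≡ lo + lo + n
pairSum-interval ys lo n large with complementaryPair (λ i → lo + i ∈? ys) n large
... | x , y , x<y , x∈ys , y∈ys , eq =
  lo + x + (lo + y) , subsetSum-pair x∈ys y∈ys (λ eq′ → <⇒≢ x<y (+-cancelˡ-≡ lo x y eq′)) ,
  trans (rearrange lo x y) (cong (lo + lo +_) eq)
  where
  rearrange : ∀ lo x y → suc (lo + x + (lo + y)) ≡ lo + lo + suc (x + y)
  rearrange = solve-∀

-- For r ∉ ys, elements of ys pair up to r inside [1, r) and to r + a inside (r, a);
-- if neither interval contains such a pair, each holds at most half of its points.
residueOfSum-all : ∀ a .{{_ : NonZero a}} {ys} → Unique ys → All (0 <_) ys → All (_< a) ys →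
                   a < 2 * length ys → ∀ {r} → r < a → ResidueOfSum ys a r
residueOfSum-all a {ys} _ _ _ _ {zero} 0<a = residueOfSum-< 0<a (subsetSum-0 ys)
residueOfSum-all a {ys} unique positive below a<2j {suc r} r<a with suc r ∈? ys
... | yes r∈ys = residueOfSum-< r<a (subsetSum-∈ r∈ys)
... | no r∉ys = gap (a ∸ suc (suc r)) (m+[n∸m]≡n r<a)
  where
  gap : ∀ L → suc (suc r) + L ≡ a → ResidueOfSum ys a (suc r)
  gap L 2+r+L≡a with 2 + r ≤? 2 * count (λ i → 1 + i ∈? ys) r
                   | 2 + L ≤? 2 * count (λ i → suc (suc r) + i ∈? ys) L
  ... | yes large | _ with pairSum-interval ys 1 r large
  ...   | s , ss , suc[s]≡2+r = residueOfSum-< r<a (subst (SubsetSum ys) (suc-injective suc[s]≡2+r) ss)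
  gap L 2+r+L≡a | no _ | yes large with pairSum-interval ys (suc (suc r)) L large
  ...   | s , ss , eq = s , ss , (begin
    s % a                 ≡⟨ cong (_% a) (suc-injective (begin
                               suc s                                ≡⟨ eq ⟩
                               suc (suc r) + suc (suc r) + L        ≡⟨ rearrange r L ⟩
                               suc (suc r + (suc (suc r) + L))      ≡⟨ cong (λ t → suc (suc r + t)) 2+r+L≡a ⟩
                               suc (suc r + a)                      ∎)) ⟩
    (suc r + a) % a       ≡⟨ [m+n]%n≡m%n (suc r) a ⟩
    suc r % a             ≡⟨ m<n⇒m%n≡m r<a ⟩
    suc r                 ∎)
    where
    open ≡-Reasoning
    rearrange : ∀ r L → suc (suc r) + suc (suc r) + L ≡ suc (suc r + (suc (suc r) + L))
    rearrange = solve-∀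
  gap L 2+r+L≡a | no small₁ | no small₂ = contradiction a<2j (≤⇒≯ (begin
    2 * length ys                      ≤⟨ *-monoʳ-≤ 2 (length≤count-∈ unique below) ⟩
    2 * count (_∈? ys) a               ≡⟨ cong (2 *_) (trans (cong (count (_∈? ys)) (sym 2+r+L≡a)) split) ⟩
    2 * (c₁ + c₂)                      ≡⟨ *-distribˡ-+ 2 c₁ c₂ ⟩
    2 * c₁ + 2 * c₂                    ≤⟨ +-mono-≤ (s≤s⁻¹ (≰⇒> small₁)) (s≤s⁻¹ (≰⇒> small₂)) ⟩
    suc r + suc L                      ≡⟨ +-suc (suc r) L ⟩
    suc (suc r) + L                    ≡⟨ 2+r+L≡a ⟩
    a                                  ∎))
    where
    open ≤-Reasoning
    c₁ c₂ : ℕ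
    c₁ = count (λ i → 1 + i ∈? ys) r
    c₂ = count (λ i → suc (suc r) + i ∈? ys) L
    split : count (_∈? ys) (suc (suc r) + L) ≡ c₁ + c₂
    split = begin-equality
      count (_∈? ys) (suc (suc r) + L)        ≡⟨ count-+ (_∈? ys) (suc (suc r)) L ⟩
      count (_∈? ys) (suc (suc r)) + c₂       ≡⟨ cong (_+ c₂) (count-skip (_∈? ys) r∉ys) ⟩
      count (_∈? ys) (suc r) + c₂             ≡⟨ cong (_+ c₂) (count-shift (_∈? ys) (0∉-positive positive) r) ⟩
      c₁ + c₂                                 ∎

length≤max : ∀ {ys b} → Unique ys → All (0 <_) ys → All (_≤ b) ys → length ys ≤ b
length≤max {ys} {b} unique positive below = begin
  length ys                 ≤⟨ length≤count-∈ unique (All.map s≤s below) ⟩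
  count (_∈? ys) (suc b)    ≡⟨ count-shift (_∈? ys) (0∉-positive positive) b ⟩
  count (λ i → suc i ∈? ys) b ≤⟨ count-≤ _ b ⟩
  b                         ∎
  where open ≤-Reasoning

length≤+count-above : ∀ {ys} p n → Unique ys → All (0 <_) ys → All (_≤ p + n) ys →
                       length ys ≤ p + count (λ i → suc p + i ∈? ys) n
length≤+count-above {ys} p n unique positive below = begin
  length ys                                             ≤⟨ length≤count-∈ unique (All.map s≤s below) ⟩
  count (_∈? ys) (suc p + n)                            ≡⟨ count-+ (_∈? ys) (suc p) n ⟩
  count (_∈? ys) (suc p) + count (λ i → suc p + i ∈? ys) n
                                                        ≡⟨ cong (_+ count (λ i → suc p + i ∈? ys) n) (count-shift (_∈? ys) (0∉-positive positive) p) ⟩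
  count (λ i → suc i ∈? ys) p + count (λ i → suc p + i ∈? ys) n
                                                        ≤⟨ +-monoˡ-≤ _ (count-≤ _ p) ⟩
  p + count (λ i → suc p + i ∈? ys) n                   ∎
  where open ≤-Reasoning

pairSum-aboveMax : ∀ {ys b r} → Unique ys → All (0 <_) ys → All (_≤ b) ys → b < r → r < 2 * length ys →
                   SubsetSum ys r
pairSum-aboveMax {ys} {b} {r} unique positive below b<r r<2j = finish (pairSum-interval ys (suc p) n large)
  where
  open ≤-Reasoning
  j p n c : ℕ
  j = length ys
  p = r ∸ suc b
  n = b ∸ p
  c = count (λ i → suc p + i ∈? ys) n
  1+b+p≡r : suc b + p ≡ r
  1+b+p≡r = m+[n∸m]≡n b<r
  p<b : p < b
  p<b = +-cancelˡ-< b p b (begin-strict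
    b + p          <⟨ n<1+n (b + p) ⟩
    suc b + p      ≡⟨ 1+b+p≡r ⟩
    r              <⟨ r<2j ⟩
    2 * j          ≤⟨ *-monoʳ-≤ 2 (length≤max unique positive below) ⟩
    2 * b          ≡⟨ cong (b +_) (+-identityʳ b) ⟩
    b + b          ∎)
  p+n≡b : p + n ≡ b
  p+n≡b = m+[n∸m]≡n (<⇒≤ p<b)
  rearrange : ∀ p n → 2 * p + (2 + n) ≡ suc (suc (p + n) + p)
  rearrange = solve-∀
  large : 2 + n ≤ 2 * c
  large = +-cancelˡ-≤ (2 * p) (2 + n) (2 * c) (begin
    2 * p + (2 + n)                     ≡⟨ rearrange p n ⟩
    suc (suc (p + n) + p)               ≡⟨ cong (λ t → suc (suc t + p)) p+n≡b ⟩
    suc (suc b + p)                     ≡⟨ cong suc 1+b+p≡r ⟩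
    suc r                               ≤⟨ r<2j ⟩
    2 * j                               ≤⟨ *-monoʳ-≤ 2 (length≤+count-above p n unique positive
                                                           (subst (λ t → All (_≤ t) ys) (sym p+n≡b) below)) ⟩
    2 * (p + c)                         ≡⟨ *-distribˡ-+ 2 p c ⟩
    2 * p + 2 * c                       ∎)
  rearrange′ : ∀ p n → suc p + suc p + n ≡ suc (suc (p + n) + p)
  rearrange′ = solve-∀
  finish : (∃ λ s → SubsetSum ys s × suc s ≡ suc p + suc p + n) → SubsetSum ys r
  finish (s , ss , eq) = subst (SubsetSum ys) (suc-injective (begin-equality
    suc s                               ≡⟨ eq ⟩
    suc p + suc p + n                   ≡⟨ rearrange′ p n ⟩
    suc (suc (p + n) + p)               ≡⟨ cong (λ t → suc (suc t + p)) p+n≡b ⟩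
    suc (suc b + p)                     ≡⟨ cong suc 1+b+p≡r ⟩
    suc r                               ∎)) ss

downwardClosed : (∀ {z} → P z → P (pred z)) → ∀ {n t} → t ≤ n → P n → P t
downwardClosed step {zero}  z≤n    p = p
downwardClosed step {suc n} t≤1+n  p with m≤n⇒m<n∨m≡n t≤1+n
... | inj₁ (s≤s t≤n) = downwardClosed step t≤n (step p)
... | inj₂ refl      = p

PairResiduesWithin : (a : ℕ) .{{_ : NonZero a}} → List ℕ → List ℕ → Set
PairResiduesWithin a ys B = ∀ {x y} → x ∈ ys → y ∈ ys → x ≢ y → (x + y) % a ∈ B

-- If all residues of two-element sums stay in {0} ∪ ys with ys = L > c > … > m, then
-- a = L + m and L = c + m, and subtracting m never leaves {0} ∪ ys. Hence m divides every
-- element, so m = 1 and {0, …, L} ⊆ {0} ∪ ys.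
module ClosedPairResidues (a : ℕ) .{{_ : NonZero a}} {L c m : ℕ} {rest : List ℕ}
  (desc : AllPairs _>_ (L ∷ c ∷ rest)) (positive : All (0 <_) (L ∷ c ∷ rest))
  (m∈rest : m ∈ rest) (m≤rest : All (m ≤_) rest) (L<a : L < a)
  (closed : PairResiduesWithin a (L ∷ c ∷ rest) (0 ∷ L ∷ c ∷ rest))
  where

  private
    ys B : List ℕ
    ys = L ∷ c ∷ rest
    B  = 0 ∷ ys

  0<m : 0 < m
  0<m = All.lookup positive (there (there m∈rest))

  c<L : c < L
  c<L = All.lookup (AllPairs.head desc) (here refl)

  rest<c : ∀ {z} → z ∈ rest → z < c
  rest<c = All.lookup (AllPairs.head (AllPairs.tail desc))

  m<c : m < c
  m<c = rest<c m∈rest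

  B≤L : ∀ {z} → z ∈ B → z ≤ L
  B≤L (here refl)                 = z≤n
  B≤L (there (here refl))         = ≤-refl
  B≤L (there (there (here refl))) = <⇒≤ c<L
  B≤L (there (there (there z∈)))  = <⇒≤ (<-trans (rest<c z∈) c<L)

  B-min : ∀ {z} → z ∈ B → 0 < z → m ≤ z
  B-min (here refl)                 ()
  B-min (there (here refl))         _ = <⇒≤ (<-trans m<c c<L)
  B-min (there (there (here refl))) _ = <⇒≤ m<c
  B-min (there (there (there z∈)))  _ = All.lookup m≤rest z∈

  B-below-m : ∀ {z} → z ∈ B → z < m → z ≡ 0
  B-below-m {zero}  _  _   = refl
  B-below-m {suc z} z∈ z<m = contradiction (B-min z∈ (s≤s z≤n)) (<⇒≱ z<m)

  B-above-c : ∀ {z} → z ∈ B → c < z → z ≡ L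
  B-above-c (here refl)                 ()
  B-above-c (there (here refl))         _   = refl
  B-above-c (there (there (here refl))) c<c = contradiction c<c (<-irrefl refl)
  B-above-c (there (there (there z∈)))  c<z = contradiction c<z (<-asym (rest<c z∈))

  m<a : m < a
  m<a = <-trans m<c (<-trans c<L L<a)

  L+m∈B : (L + m) % a ∈ B
  L+m∈B = closed (here refl) (there (there m∈rest)) (>⇒≢ (<-trans m<c c<L))

  L+m≡a : L + m ≡ a
  L+m≡a with L + m <? a
  ... | yes L+m<a = contradiction (B≤L (subst (_∈ B) (m<n⇒m%n≡m L+m<a) L+m∈B)) (<⇒≱ (m<m+n L 0<m))
  ... | no L+m≮a = ≤-antisym (m∸n≡0⇒m≤n t≡0) a≤L+m
    where
    open ≤-Reasoning
    a≤L+m : a ≤ L + m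
    a≤L+m = ≮⇒≥ L+m≮a
    t : ℕ
    t = L + m ∸ a
    t<m : t < m
    t<m = +-cancelʳ-< a t m (begin-strict
      t + a   ≡⟨ m∸n+n≡m a≤L+m ⟩
      L + m   ≡⟨ +-comm L m ⟩
      m + L   <⟨ +-monoʳ-< m L<a ⟩
      m + a   ∎)
    t≡[L+m]%a : t ≡ (L + m) % a
    t≡[L+m]%a = trans (sym (m<n⇒m%n≡m (<-trans t<m m<a))) (m≤n⇒[n∸m]%m≡n%m a≤L+m)
    t≡0 : t ≡ 0
    t≡0 = B-below-m (subst (_∈ B) (sym t≡[L+m]%a) L+m∈B) t<m

  c+m≡L : c + m ≡ L
  c+m≡L = B-above-c (subst (_∈ B) (m<n⇒m%n≡m c+m<a) c+m∈B) (m<m+n c 0<m)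
    where
    c+m<a : c + m < a
    c+m<a = subst (c + m <_) L+m≡a (+-monoˡ-< m c<L)
    c+m∈B : (c + m) % a ∈ B
    c+m∈B = closed (there (here refl)) (there (there m∈rest)) (>⇒≢ m<c)

  B-descend : ∀ {z} → z ∈ B → 0 < z → z ∸ m ∈ B
  B-descend (here refl)         ()
  B-descend (there (here refl)) _ =
    subst (_∈ B) (trans (sym (m+n∸n≡m c m)) (cong (_∸ m) c+m≡L)) (there (there (here refl)))
  B-descend {z} (there (there z∈c∷rest)) 0<z =
    subst (_∈ B) [L+z]%a≡z∸m (closed (here refl) (there z∈c∷rest) (>⇒≢ z<L))
    where
    open ≡-Reasoning
    z<L : z < L
    z<L = All.lookup (AllPairs.head desc) z∈c∷rest
    m≤z : m ≤ z
    m≤z = B-min (there (there z∈c∷rest)) 0<z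
    [L+z]%a≡z∸m : (L + z) % a ≡ z ∸ m
    [L+z]%a≡z∸m = begin
      (L + z) % a              ≡⟨ cong (λ t → (L + t) % a) (m∸n+n≡m m≤z) ⟨
      (L + (z ∸ m + m)) % a    ≡⟨ cong (_% a) (x∙yz≈y∙xz L (z ∸ m) m) ⟩
      (z ∸ m + (L + m)) % a    ≡⟨ cong (λ t → (z ∸ m + t) % a) L+m≡a ⟩
      (z ∸ m + a) % a          ≡⟨ [m+n]%n≡m%n (z ∸ m) a ⟩
      (z ∸ m) % a              ≡⟨ m<n⇒m%n≡m (≤-<-trans (m∸n≤m z m) (<-trans z<L L<a)) ⟩
      z ∸ m                    ∎

  m∣B : ∀ {z} → z ∈ B → m ∣ z
  m∣B {z} = <-rec (λ z → z ∈ B → m ∣ z) step z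
    where
    step : ∀ z → (∀ {w} → w < z → w ∈ B → m ∣ w) → z ∈ B → m ∣ z
    step zero    _   _  = m ∣0
    step (suc z) rec z∈ = ∣m∸n∣n⇒∣m m (B-min z∈ (s≤s z≤n))
                            (rec (∸-monoʳ-< 0<m (B-min z∈ (s≤s z≤n))) (B-descend z∈ (s≤s z≤n))) ∣-refl

  m≡1 : gcdList (a ∷ ys) ≡ 1 → m ≡ 1
  m≡1 coprime = ∣1⇒≡1 (subst (m ∣_) coprime (∣-gcdList (a ∷ ys) (m∣a ∷ All.tabulate (m∣B ∘ there))))
    where
    m∣a : m ∣ a
    m∣a = subst (m ∣_) L+m≡a (∣m∣n⇒∣m+n (m∣B (there (here refl))) ∣-refl)

  a≤1+length : gcdList (a ∷ ys) ≡ 1 → a ≤ suc (length ys)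
  a≤1+length coprime = begin
    a                          ≡⟨ L+m≡a ⟨
    L + m                      ≡⟨ cong (L +_) (m≡1 coprime) ⟩
    L + 1                      ≡⟨ +-comm L 1 ⟩
    suc L                      ≡⟨ count-all (_∈? B) (suc L) (λ t<1+L → B-interval (s≤s⁻¹ t<1+L)) ⟨
    count (_∈? B) (suc L)      ≤⟨ count-∈≤length (suc L) B ⟩
    suc (length ys)            ∎
    where
    open ≤-Reasoning
    B-pred : ∀ {z} → z ∈ B → pred z ∈ B
    B-pred {zero}  z∈ = z∈
    B-pred {suc z} z∈ = subst (λ k → suc z ∸ k ∈ B) (m≡1 coprime) (B-descend z∈ (s≤s z≤n))
    B-interval : ∀ {t} → t ≤ L → t ∈ B
    B-interval t≤L = downwardClosed B-pred t≤L (there (here refl))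

pairResidue-outside⊎closed : ∀ a .{{_ : NonZero a}} ys B →
  (∃ λ s → SubsetSum ys s × s % a ∉ B) ⊎ PairResiduesWithin a ys B
pairResidue-outside⊎closed a ys B with anyUpTo? (λ s → subsetSum? ys s ×-dec ¬? (s % a ∈? B)) (suc (sum ys))
... | yes (s , _ , ss , s∉B) = inj₁ (s , ss , s∉B)
... | no none = inj₂ closed
  where
  closed : PairResiduesWithin a ys B
  closed {x} {y} x∈ y∈ x≢y with (x + y) % a ∈? B
  ... | yes x+y∈B = x+y∈B
  ... | no x+y∉B  = contradiction (x + y , s≤s (subsetSum-≤ ss) , ss , x+y∉B) none
    where
    ss : SubsetSum ys (x + y)
    ss = subsetSum-pair x∈ y∈ x≢y

residueOfSum-extra : ∀ a .{{_ : NonZero a}} {L c r rs} → AllPairs _>_ (L ∷ c ∷ r ∷ rs) →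
                     All (0 <_) (L ∷ c ∷ r ∷ rs) → L < a → 2 * length (L ∷ c ∷ r ∷ rs) ≤ a →
                     gcdList (a ∷ L ∷ c ∷ r ∷ rs) ≡ 1 →
                     ∃ λ s → SubsetSum (L ∷ c ∷ r ∷ rs) s × s % a ∉ 0 ∷ L ∷ c ∷ r ∷ rs
residueOfSum-extra a {L} {c} {r} {rs} desc positive L<a large coprime = conclude (pairResidue-outside⊎closed a ys B)
  where
  ys B : List ℕ
  ys = L ∷ c ∷ r ∷ rs
  B  = 0 ∷ ys
  j m : ℕ
  j = length ys
  m = min r rs
  1+j<2*j : suc j < 2 * j
  1+j<2*j = subst (suc j <_) (cong (j +_) (sym (+-identityʳ j))) (+-monoˡ-< j {1} {j} (s≤s (s≤s z≤n)))
  m∈ : m ∈ r ∷ rs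
  m∈ with argmin-sel id r rs
  ... | inj₁ m≡r  = here m≡r
  ... | inj₂ m∈rs = there m∈rs
  m≤ : All (m ≤_) (r ∷ rs)
  m≤ = min≤⊤ r rs ∷ min≤xs r rs
  conclude : (∃ λ s → SubsetSum ys s × s % a ∉ B) ⊎ PairResiduesWithin a ys B → ∃ λ s → SubsetSum ys s × s % a ∉ B
  conclude (inj₁ outside) = outside
  conclude (inj₂ closed)  =
    contradiction (≤-trans large (ClosedPairResidues.a≤1+length a desc positive m∈ m≤ L<a closed coprime)) (<⇒≱ 1+j<2*j)

triangular : ℕ → ℕ
triangular zero    = 0
triangular (suc n) = suc n + triangular n

#sums-lower : AllPairs _>_ xs → All (0 <_) xs → suc (triangular (length xs)) ≤ #sums xs
#sums-lower {[]} [] [] = ≤-refl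
#sums-lower {a ∷ ys} (a>ys ∷ desc) (0<a ∷ positive) = begin
  suc (suc (length ys) + triangular (length ys))   ≡⟨ cong suc (+-comm (suc (length ys)) _) ⟩
  suc (triangular (length ys)) + length (0 ∷ ys)   ≤⟨ +-monoˡ-≤ _ (#sums-lower desc positive) ⟩
  #sums ys + length (0 ∷ ys)                       ≤⟨ #sums-∷-distinct a ys (0∷-unique desc positive) (0<a ∷ a>ys)
                                                        (All.tabulate λ r∈ → residueOfSum-0∷ (All.lookup (0<a ∷ a>ys) r∈) r∈) ⟩
  #sums (a ∷ ys)                                   ∎
  where
  open ≤-Reasoning
  instance
    a≢0 : NonZero a
    a≢0 = >-nonZero 0<a

#sums-smallMax : ∀ {a ys} → AllPairs _>_ (a ∷ ys) → All (0 <_) (a ∷ ys) → a < 2 * length ys →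
                 suc (triangular (length ys)) + a ≤ #sums (a ∷ ys)
#sums-smallMax {a} {ys} (a>ys ∷ desc) (0<a ∷ positive) a<2j = begin
  suc (triangular (length ys)) + a    ≤⟨ +-monoˡ-≤ a (#sums-lower desc positive) ⟩
  #sums ys + a                        ≡⟨ cong (#sums ys +_) (count-all U? a _) ⟨
  #sums ys + count U? a               ≤⟨ #sums-∷-residues a ys U? (λ r<a _ →
                                           residueOfSum-all a (AllPairs.map >⇒≢ desc) positive a>ys a<2j r<a) ⟩
  #sums (a ∷ ys)                      ∎
  where
  open ≤-Reasoning
  instance
    a≢0 : NonZero a
    a≢0 = >-nonZero 0<a

count-interval : ∀ {lo hi} N → lo ≤ hi → hi ≤ N → hi ∸ lo ≤ count (λ r → lo ≤? r ×-dec r <? hi) N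
count-interval {lo} {hi} N lo≤hi hi≤N = begin
  hi ∸ lo                                   ≡⟨ count-all (I? ∘ (lo +_)) (hi ∸ lo) inside ⟨
  count (I? ∘ (lo +_)) (hi ∸ lo)            ≤⟨ m≤n+m _ _ ⟩
  count I? lo + count (I? ∘ (lo +_)) (hi ∸ lo) ≡⟨ count-+ I? lo (hi ∸ lo) ⟨
  count I? (lo + (hi ∸ lo))                 ≡⟨ cong (count I?) (m+[n∸m]≡n lo≤hi) ⟩
  count I? hi                               ≤⟨ count-monoʳ I? hi≤N ⟩
  count I? N                                ∎
  where
  open ≤-Reasoning
  I? : Decidable (λ r → lo ≤ r × r < hi)
  I? r = lo ≤? r ×-dec r <? hi
  inside : ∀ {i} → i < hi ∸ lo → lo ≤ lo + i × lo + i < hi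
  inside {i} i<hi∸lo = m≤m+n lo i , subst (lo + i <_) (m+[n∸m]≡n lo≤hi) (+-monoʳ-< lo i<hi∸lo)

#sums-dense : ∀ {a b zs} → AllPairs _>_ (a ∷ b ∷ zs) → All (0 <_) (a ∷ b ∷ zs) →
              b < 2 * length zs → 2 * length (b ∷ zs) ≤ a →
              triangular (length (b ∷ zs)) + 2 * length (b ∷ zs) ≤ #sums (a ∷ b ∷ zs)
#sums-dense {a} {b} {zs} (a>ys ∷ desc) (0<a ∷ positive) b<2i′ 2i≤a = begin
  triangular i + 2 * i                      ≡⟨ cong (triangular i +_) (m+[n∸m]≡n 1+b≤2i) ⟨
  triangular i + (suc b + D)                ≡⟨ rearrange (length zs) (triangular (length zs)) b D ⟩
  triangular (length zs) + b + (suc i + D)  ≤⟨ +-monoˡ-≤ (suc i + D) (+-monoˡ-≤ b (n≤1+n (triangular (length zs)))) ⟩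
  suc (triangular (length zs)) + b + (suc i + D)
    ≤⟨ +-mono-≤ (#sums-smallMax desc positive b<2i′)
                (+-mono-≤ (length≤count-∈ (0∷-unique desc positive) (0<a ∷ a>ys)) (count-interval a 1+b≤2i 2i≤a)) ⟩
  #sums ys + (count B? a + count I? a)      ≡⟨ cong (#sums ys +_) (count-∪ B? I? a disjoint) ⟨
  #sums ys + count (B? ∪? I?) a             ≤⟨ #sums-∷-residues a ys (B? ∪? I?) reach ⟩
  #sums (a ∷ ys)                            ∎
  where
  open ≤-Reasoning
  instance
    a≢0 : NonZero a
    a≢0 = >-nonZero 0<a
  ys : List ℕ
  ys = b ∷ zs
  i D : ℕ
  i = length ys
  D = 2 * i ∸ suc b
  1+b≤2i : suc b ≤ 2 * i
  1+b≤2i = ≤-trans b<2i′ (*-monoʳ-≤ 2 (n≤1+n _))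
  rearrange : ∀ i′ t b D → suc i′ + t + (suc b + D) ≡ t + b + (suc (suc i′) + D)
  rearrange = solve-∀
  ys≤b : All (_≤ b) ys
  ys≤b = ≤-refl ∷ All.map <⇒≤ (AllPairs.head desc)
  B? : Decidable (_∈ 0 ∷ ys)
  B? = _∈? 0 ∷ ys
  I? : Decidable (λ r → suc b ≤ r × r < 2 * i)
  I? r = suc b ≤? r ×-dec r <? 2 * i
  disjoint : ∀ {r} → r ∈ 0 ∷ ys → suc b ≤ r × r < 2 * i → ⊥
  disjoint (here refl)  (() , _)
  disjoint (there r∈ys) (b<r , _) = <⇒≱ b<r (All.lookup ys≤b r∈ys)
  reach : ∀ {r} → r < a → r ∈ 0 ∷ ys ⊎ (suc b ≤ r × r < 2 * i) → ResidueOfSum ys a r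
  reach r<a (inj₁ r∈)           = residueOfSum-0∷ r<a r∈
  reach r<a (inj₂ (b<r , r<2i)) =
    residueOfSum-< r<a (pairSum-aboveMax (AllPairs.map >⇒≢ desc) positive ys≤b b<r r<2i)

#sums-∷-extra : ∀ {a L c r rs} → AllPairs _>_ (a ∷ L ∷ c ∷ r ∷ rs) → All (0 <_) (a ∷ L ∷ c ∷ r ∷ rs) →
                2 * length (L ∷ c ∷ r ∷ rs) ≤ a → gcdList (a ∷ L ∷ c ∷ r ∷ rs) ≡ 1 →
                #sums (L ∷ c ∷ r ∷ rs) + suc (suc (length (L ∷ c ∷ r ∷ rs))) ≤ #sums (a ∷ L ∷ c ∷ r ∷ rs)
#sums-∷-extra {a} {L} {c} {r} {rs} (a>ys ∷ desc) (0<a ∷ positive) large coprime =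
  conclude (residueOfSum-extra a desc positive (All.lookup a>ys (here refl)) large coprime)
  where
  instance
    a≢0 : NonZero a
    a≢0 = >-nonZero 0<a
  ys : List ℕ
  ys = L ∷ c ∷ r ∷ rs
  conclude : (∃ λ s → SubsetSum ys s × s % a ∉ 0 ∷ ys) → #sums ys + suc (suc (length ys)) ≤ #sums (a ∷ ys)
  conclude (s , ss , s∉B) = #sums-∷-distinct a ys {rs = s % a ∷ 0 ∷ ys} unique (m%n<n s a ∷ 0<a ∷ a>ys)
                              ((s , ss , refl) ∷ All.tabulate λ r∈ → residueOfSum-0∷ (All.lookup (0<a ∷ a>ys) r∈) r∈)
    where
    unique : Unique (s % a ∷ 0 ∷ ys)
    unique = All.tabulate (λ z∈B s%a≡z → s∉B (subst (_∈ 0 ∷ ys) (sym s%a≡z) z∈B)) ∷ 0∷-unique desc positive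

#sums-∷-coprime-doubling : ∀ {a ys} → gcdList ys ≢ 1 → gcdList (a ∷ ys) ≡ 1 → #sums ys + #sums ys ≤ #sums (a ∷ ys)
#sums-∷-coprime-doubling {a} {ys} ¬coprime coprime = #sums-∷-doubling a ys disjoint
  where
  disjoint : ∀ {s} → SubsetSum ys s → ¬ SubsetSum ys (a + s)
  disjoint {s} ss ss′ = ¬coprime (∣1⇒≡1 (subst (gcdList ys ∣_) coprime (gcd-greatest d∣a ∣-refl)))
    where
    d∣a : gcdList ys ∣ a
    d∣a = ∣m+n∣m⇒∣n (subst (gcdList ys ∣_) (+-comm a s) (subsetSum-∣ (gcdList-∣ ys) ss′)) (subsetSum-∣ (gcdList-∣ ys) ss)

2*n≤triangular+2 : ∀ n → 2 * n ≤ triangular n + 2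
2*n≤triangular+2 zero    = z≤n
2*n≤triangular+2 (suc n) = begin
  2 * suc n                  ≡⟨ cong (suc n +_) (+-identityʳ (suc n)) ⟩
  suc n + suc n              ≤⟨ +-monoʳ-≤ (suc n) (≤-trans (s≤s (n≤triangular n)) (≤-trans (n≤1+n _) (≤-reflexive (+-comm 2 _)))) ⟩
  suc n + (triangular n + 2) ≡⟨ +-assoc (suc n) (triangular n) 2 ⟨
  triangular (suc n) + 2     ∎
  where
  open ≤-Reasoning
  n≤triangular : ∀ n → n ≤ triangular n
  n≤triangular zero    = z≤n
  n≤triangular (suc n) = m≤m+n (suc n) (triangular n)

#sums-largeMax : ∀ {a ys} → 2 ≤ length ys → AllPairs _>_ (a ∷ ys) → All (0 <_) (a ∷ ys) →
                 gcdList (a ∷ ys) ≡ 1 → 2 * length ys ≤ a → triangular (length ys) + 2 * length ys ≤ #sums (a ∷ ys)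
#sums-largeMax {ys = []}         ()
#sums-largeMax {ys = _ ∷ []}     (s≤s ())
#sums-largeMax {ys = _ ∷ _ ∷ []} _ desc positive _ _ = #sums-lower desc positive
#sums-largeMax {a} {b ∷ zs@(_ ∷ _ ∷ _)} _ desc positive coprime 2i≤a =
  byDensity (b <? 2 * length zs) (#sums-largeMax (s≤s (s≤s z≤n)) (AllPairs.tail desc) (All.tail positive))
  where
  open ≤-Reasoning
  i : ℕ
  i = length (b ∷ zs)
  InductionHypothesis : Set
  InductionHypothesis = gcdList (b ∷ zs) ≡ 1 → 2 * length zs ≤ b → triangular (length zs) + 2 * length zs ≤ #sums (b ∷ zs)
  byCoprimality : Dec (gcdList (b ∷ zs) ≡ 1) → 2 * length zs ≤ b → InductionHypothesis → triangular i + 2 * i ≤ #sums (a ∷ b ∷ zs)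
  byCoprimality (yes coprime′) 2i′≤b ih = begin
    triangular i + 2 * i                                   ≡⟨ rearrange (length zs) (triangular (length zs)) ⟩
    triangular (length zs) + 2 * length zs + suc (suc i)   ≤⟨ +-monoˡ-≤ _ (ih coprime′ 2i′≤b) ⟩
    #sums (b ∷ zs) + suc (suc i)                           ≤⟨ #sums-∷-extra desc positive 2i≤a coprime ⟩
    #sums (a ∷ b ∷ zs)                                     ∎
    where
    rearrange : ∀ i′ t → suc i′ + t + 2 * suc i′ ≡ t + 2 * i′ + suc (suc (suc i′))
    rearrange = solve-∀
  byCoprimality (no ¬coprime′) _ _ = begin
    triangular i + 2 * i                    ≤⟨ +-monoʳ-≤ (triangular i) (2*n≤triangular+2 i) ⟩
    triangular i + (triangular i + 2)       ≡⟨ rearrange (triangular i) ⟩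
    suc (triangular i) + suc (triangular i) ≤⟨ +-mono-≤ lower lower ⟩
    #sums (b ∷ zs) + #sums (b ∷ zs)         ≤⟨ #sums-∷-coprime-doubling {a} {b ∷ zs} ¬coprime′ coprime ⟩
    #sums (a ∷ b ∷ zs)                      ∎
    where
    rearrange : ∀ t → t + (t + 2) ≡ suc t + suc t
    rearrange = solve-∀
    lower : suc (triangular i) ≤ #sums (b ∷ zs)
    lower = #sums-lower (AllPairs.tail desc) (All.tail positive)
  byDensity : Dec (b < 2 * length zs) → InductionHypothesis → triangular i + 2 * i ≤ #sums (a ∷ b ∷ zs)
  byDensity (yes b<2i′) _  = #sums-dense desc positive b<2i′ 2i≤a
  byDensity (no b≮2i′)  ih = byCoprimality (gcdList (b ∷ zs) ≟ 1) (≮⇒≥ b≮2i′) ih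

-- The golden ratio

ℤ-pos-∸ : ∀ {m n} → n ≤ m → ℤ.+ m ℤ.- ℤ.+ n ≡ ℤ.+ (m ∸ n)
ℤ-pos-∸ {m} {n} n≤m = trans (ℤP.m-n≡m⊖n m n) (ℤP.⊖-≥ n≤m)

-- θ m ≤ e means 2e − m ≥ √5 m; with m = n + 3 and e ≥ 2m − 1 this follows from
-- (3n + 7)² ≥ 5 (n + 3)².
atLeastGolden : ∀ {e m} → 3 ≤ m → 2 * m ≤ suc e → AtLeastGoldenTimes (ℤ.+ e) m
atLeastGolden {e} {m@(suc (suc (suc n)))} (s≤s (s≤s (s≤s _))) 2m≤1+e =
  subst (ℤ.+ m ℤ.≤_) (ℤP.pos-* 2 e) (ℤ.+≤+ m≤2e) ,
  subst₂ ℤ._≤_ (trans (ℤP.pos-* (5 * m) m) (cong (ℤ._* ℤ.+ m) (ℤP.pos-* 5 m)))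
               (trans (ℤP.pos-* y y) (sym (cong₂ ℤ._*_ 2e-m≡y 2e-m≡y)))
               (ℤ.+≤+ (begin
                  5 * m * m                                  ≤⟨ m≤m+n _ _ ⟩
                  5 * m * m + (4 * n * n + 12 * n + 4)       ≡⟨ square n ⟩
                  (3 * n + 7) * (3 * n + 7)                  ≤⟨ *-mono-≤ 3n+7≤y 3n+7≤y ⟩
                  y * y                                      ∎))
  where
  open ≤-Reasoning
  y : ℕ
  y = 2 * e ∸ m
  double : ∀ n → (3 * n + 7) + suc (suc (suc n)) ≡ 2 * (2 * n + 5)
  double = solve-∀
  square : ∀ n → 5 * suc (suc (suc n)) * suc (suc (suc n)) + (4 * n * n + 12 * n + 4) ≡ (3 * n + 7) * (3 * n + 7)
  square = solve-∀
  2n+5≤e : 2 * n + 5 ≤ e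
  2n+5≤e = s≤s⁻¹ (subst (_≤ suc e) (unfold n) 2m≤1+e)
    where
    unfold : ∀ n → 2 * suc (suc (suc n)) ≡ suc (2 * n + 5)
    unfold = solve-∀
  3n+7+m≤2e : (3 * n + 7) + m ≤ 2 * e
  3n+7+m≤2e = subst (_≤ 2 * e) (sym (double n)) (*-monoʳ-≤ 2 2n+5≤e)
  3n+7≤y : 3 * n + 7 ≤ y
  3n+7≤y = m+n≤o⇒m≤o∸n (3 * n + 7) 3n+7+m≤2e
  m≤2e : m ≤ 2 * e
  m≤2e = m+n≤o⇒n≤o (3 * n + 7) 3n+7+m≤2e
  2e-m≡y : ℤ.+ 2 ℤ.* ℤ.+ e ℤ.- ℤ.+ m ≡ ℤ.+ y
  2e-m≡y = trans (cong (ℤ._- ℤ.+ m) (sym (ℤP.pos-* 2 e))) (ℤ-pos-∸ m≤2e)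

atLeastGolden-shifted : ∀ {c t i} → 2 ≤ i → t + 2 * i ≤ suc c →
                        AtLeastGoldenTimes ((ℤ.+ c ℤ.+ ℤ.+ 4) ℤ.- ℤ.+ t) (suc i + 1)
atLeastGolden-shifted {c} {t} {i} 2≤i t+2i≤1+c =
  subst (λ x → AtLeastGoldenTimes x (suc i + 1)) (sym x≡e) (atLeastGolden (≤-trans (s≤s 2≤i) (m≤m+n _ 1)) bound)
  where
  open ≤-Reasoning
  rearrange : ∀ i t → 2 * i + 3 + t ≡ t + 2 * i + 3
  rearrange = solve-∀
  2i+3+t≤c+4 : 2 * i + 3 + t ≤ c + 4
  2i+3+t≤c+4 = begin
    2 * i + 3 + t     ≡⟨ rearrange i t ⟩
    t + 2 * i + 3     ≤⟨ +-monoˡ-≤ 3 t+2i≤1+c ⟩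
    suc c + 3         ≡⟨ +-suc c 3 ⟨
    c + 4             ∎
  x≡e : (ℤ.+ c ℤ.+ ℤ.+ 4) ℤ.- ℤ.+ t ≡ ℤ.+ (c + 4 ∸ t)
  x≡e = trans (cong (ℤ._- ℤ.+ t) (sym (ℤP.pos-+ c 4))) (ℤ-pos-∸ (m+n≤o⇒n≤o (2 * i + 3) 2i+3+t≤c+4))
  unfold : ∀ i → 2 * (suc i + 1) ≡ suc (2 * i + 3)
  unfold = solve-∀
  bound : 2 * (suc i + 1) ≤ suc (c + 4 ∸ t)
  bound = subst (_≤ suc (c + 4 ∸ t)) (sym (unfold i)) (s≤s (m+n≤o⇒m≤o∸n (2 * i + 3) 2i+3+t≤c+4))

triangular-double : ∀ n → triangular n * 2 ≡ suc n * n
triangular-double zero    = refl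
triangular-double (suc n) = begin
  (suc n + triangular n) * 2       ≡⟨ *-distribʳ-+ 2 (suc n) (triangular n) ⟩
  suc n * 2 + triangular n * 2     ≡⟨ cong (suc n * 2 +_) (triangular-double n) ⟩
  suc n * 2 + suc n * n            ≡⟨ rearrange n ⟩
  suc (suc n) * suc n              ∎
  where
  open ≡-Reasoning
  rearrange : ∀ n → suc n * 2 + suc n * n ≡ suc (suc n) * suc n
  rearrange = solve-∀

tri≡triangular : ∀ n → tri (suc n) ≡ triangular n
tri≡triangular n = trans (cong (_/ 2) (sym (triangular-double n))) (m*n/n≡m (triangular n) 2)

AllPairs-reverse : ∀ {R : ℕ → ℕ → Set} {xs} → AllPairs R xs → AllPairs (flip R) (reverse xs)
AllPairs-reverse []                       = []
AllPairs-reverse {xs = x ∷ xs} (x~xs ∷ pairs) = subst (AllPairs _) (sym (unfold-reverse x xs))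
  (AllPairs.++⁺ (AllPairs-reverse pairs) ([] ∷ []) (All.tabulate λ y∈ → All.lookup x~xs (Any.reverse⁻ y∈) ∷ []))

reverse-last : ∀ (A : List ℕ) {x} → last A ≡ just x → ∃ λ ys → reverse A ≡ x ∷ ys
reverse-last (y ∷ [])           refl  = [] , refl
reverse-last (y ∷ A@(_ ∷ _))    last≡ with reverse-last A last≡
... | ys , eq = ys ∷ʳ y , trans (unfold-reverse y A) (cong (_∷ʳ y) eq)

gcdList-reverse : ∀ xs → gcdList (reverse xs) ≡ gcdList xs
gcdList-reverse xs = ∣-antisym
  (∣-gcdList xs (All.tabulate λ x∈ → All.lookup (gcdList-∣ (reverse xs)) (Any.reverse⁺ x∈)))
  (∣-gcdList (reverse xs) (All.tabulate λ x∈ → All.lookup (gcdList-∣ xs) (Any.reverse⁻ x∈)))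

#sums-reverse≤cardS : ∀ A → #sums (reverse A) ≤ suc (cardS A)
#sums-reverse≤cardS A = ≤-trans (count-mono (subsetSum? (reverse A)) (subsetSum? A) _ λ _ → subsetSum-↭ (↭-reverse A))
                                (count-subsetSum≤cardS _ A)

cardS-bounds : ∀ {k c a ys} → suc (length ys) ≡ k → 3 ≤ k → AllPairs _>_ (a ∷ ys) → All (0 <_) (a ∷ ys) →
               gcdList (a ∷ ys) ≡ 1 → #sums (a ∷ ys) ≤ suc c →
               (a ≤ 2 * k ∸ 3 → a + tri k ≤ c) ×
               (2 * k ∸ 2 ≤ a → AtLeastGoldenTimes ((ℤ.+ c ℤ.+ ℤ.+ 4) ℤ.- ℤ.+ tri k) (k + 1))
cardS-bounds {c = c} {a} {ys} refl (s≤s 2≤i) desc positive coprime sums≤1+c = smallTop , largeTop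
  where
  open ≤-Reasoning
  i : ℕ
  i = length ys
  smallTop : a ≤ 2 * suc i ∸ 3 → a + tri (suc i) ≤ c
  smallTop a≤2i+2-3 = subst (λ t → a + t ≤ c) (sym (tri≡triangular i)) (s≤s⁻¹ (begin
    suc (a + triangular i)      ≡⟨ cong suc (+-comm a (triangular i)) ⟩
    suc (triangular i) + a      ≤⟨ #sums-smallMax desc positive a<2i ⟩
    #sums (a ∷ ys)              ≤⟨ sums≤1+c ⟩
    suc c                       ∎))
    where
    a<2i : a < 2 * i
    a<2i = subst (_≤ 2 * i) (+-comm a 1)
             (m≤o∸n⇒m+n≤o a (≤-trans (s≤s z≤n) (≤-trans 2≤i (m≤m+n i _)))
                          (subst (a ≤_) (cong (_∸ 3) (*-suc 2 i)) a≤2i+2-3))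
  largeTop : 2 * suc i ∸ 2 ≤ a → AtLeastGoldenTimes ((ℤ.+ c ℤ.+ ℤ.+ 4) ℤ.- ℤ.+ tri (suc i)) (suc i + 1)
  largeTop 2i+2-2≤a = subst (λ t → AtLeastGoldenTimes ((ℤ.+ c ℤ.+ ℤ.+ 4) ℤ.- ℤ.+ t) (suc i + 1)) (sym (tri≡triangular i))
    (atLeastGolden-shifted {c} {triangular i} 2≤i (≤-trans (#sums-largeMax 2≤i desc positive coprime 2i≤a) sums≤1+c))
    where
    2i≤a : 2 * i ≤ a
    2i≤a = subst (_≤ a) (cong (_∸ 2) (*-suc 2 i)) 2i+2-2≤a

theorem3p2 : (k : ℕ) → 3 ≤ k → (A : List ℕ) → length A ≡ k →
    All (0 <_) A → Linked _<_ A → gcdList A ≡ 1 →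
    (ak : ℕ) → last A ≡ just ak →
    (ak ≤ 2 * k ∸ 3 → ak + tri k ≤ cardS A) ×
    (2 * k ∸ 2 ≤ ak → AtLeastGoldenTimes ((ℤ.+ cardS A ℤ.+ ℤ.+ 4) ℤ.- ℤ.+ tri k) (k + 1))
theorem3p2 k 3≤k A |A|≡k positive increasing coprime ak last≡ak =
  let ys , reverse≡ = reverse-last A last≡ak in
  cardS-bounds (trans (cong length (sym reverse≡)) (trans (length-reverse A) |A|≡k)) 3≤k
    (subst (AllPairs _>_) reverse≡ (AllPairs-reverse (Linked⇒AllPairs <-trans increasing)))
    (subst (All (0 <_)) reverse≡ (All.tabulate λ x∈ → All.lookup positive (Any.reverse⁻ x∈)))
    (trans (cong gcdList (sym reverse≡)) (trans (gcdList-reverse A) coprime))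
    (subst (λ xs → #sums xs ≤ suc (cardS A)) reverse≡ (#sums-reverse≤cardS A))
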